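{- The basis graph $G(M)$ of any matroid $M=(E,\mathcal{B})$ is a meshed $S_3$-graph.
   Context: A matroid $M$ on a finite set $E$ is a nonempty family $\mathcal{B}$ of subsets of $E$ (bases) such that for all $A,B\in\mathcal{B}$ and $e\in A\setminus B$ there is $f\in B\setminus A$ with $(A\setminus\{e\})\cup\{f\}\in\mathcal{B}$. Its basis graph $G(M)$ has vertex set $\mathcal{B}$, two bases $A,B$ adjacent iff $|A\triangle B|=2$. In a connected graph, $d$ is the shortest-path distance, $[u,v]=\{w:d(u,w)+d(w,v)=d(u,v)\}$; a set is convex if it contains $[u,v]$ for all its $u,v$; a halfspace is a convex set with convex complement; $G$ is an $S_3$-graph if every convex set $A$ and vertex $x\notin A$ are separated by a halfspace containing $A$ and not $x$. $G$ is meshed if for any $u,v,w$ with $d(v,w)=2$ there is a common neighbor $x$ of $v,w$ with $2d(u,x)\le d(u,v)+d(u,w)$. -}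

module Defs where

open import Data.Nat using (ℕ; zero; suc; _+_; _*_; _≤_)
open import Data.Bool using (Bool; true; false; T; not)
open import Data.Fin using (Fin)
open import Data.Fin.Subset using (Subset; _∈_; _∉_; _∪_; _─_; _-_; ⁅_⁆; ∣_∣)
open import Data.Product using (Σ; ∃; _×_; _,_; proj₁)
open import Relation.Binary.PropositionalEquality using (_≡_)

record Matroid (n : ℕ) : Set where
  field
    IsBasis  : Subset n → Bool
    nonempty : ∃ λ (A : Subset n) → T (IsBasis A)
    exchange : ∀ (A B : Subset n) → T (IsBasis A) → T (IsBasis B) →
               ∀ (e : Fin n) → e ∈ A → e ∉ B →
               ∃ λ (f : Fin n) → f ∈ B × f ∉ A × T (IsBasis ((A - e) ∪ ⁅ f ⁆))

_△_ : ∀ {n} → Subset n → Subset n → Subset n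
A △ B = (A ─ B) ∪ (B ─ A)

Basis : ∀ {n} → Matroid n → Set
Basis M = Σ (Subset _) (λ A → T (Matroid.IsBasis M A))

BasisAdj : ∀ {n} (M : Matroid n) → Basis M → Basis M → Set
BasisAdj M A B = ∣ proj₁ A △ proj₁ B ∣ ≡ 2

module GraphNotions {V : Set} (Adj : V → V → Set) where

  data Walk : V → V → ℕ → Set where
    here : ∀ {u} → Walk u u 0
    step : ∀ {u v w k} → Adj u v → Walk v w k → Walk u w (suc k)

  Connected : Set
  Connected = ∀ u v → ∃ λ k → Walk u v k

  Dist : V → V → ℕ → Set
  Dist u v k = Walk u v k × (∀ m → Walk u v m → k ≤ m)

  InInterval : V → V → V → Set
  InInterval u v w = ∃ λ a → ∃ λ b →
    Dist u w a × Dist w v b × Dist u v (a + b)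

  Convex : (V → Bool) → Set
  Convex A = ∀ u v w → T (A u) → T (A v) → InInterval u v w → T (A w)

  Halfspace : (V → Bool) → Set
  Halfspace H = Convex H × Convex (λ x → not (H x))

  IsS3 : Set
  IsS3 = ∀ (A : V → Bool) → Convex A → ∀ x → T (not (A x)) →
         ∃ λ (H : V → Bool) → Halfspace H ×
           (∀ y → T (A y) → T (H y)) × T (not (H x))

  Meshed : Set
  Meshed = ∀ u v w → Dist v w 2 →
    ∃ λ x → Adj v x × Adj x w ×
      (∀ a b c → Dist u v a → Dist u w b → Dist u x c → 2 * c ≤ a + b)

{-# OPTIONS --safe #-}
module Submission where

-- Distances in G(M) are half the Hamming distance |A △ B|: every step changes two
-- coordinates, and by the exchange axiom every basis A ≠ B has a neighbour A - e + f one
-- step closer to B.  Hence C ∈ [A, B] iff A ∩ B ⊆ C ⊆ A ∪ B, coordinatewise.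
--
-- Meshed: bases V, W at distance 2 have two common neighbours X, Y that differ on all of
-- V △ W, so d(U, X) + d(U, Y) = d(U, V) + d(U, W) for every U, and the nearer one works.
--
-- S₃: {B : e ∈ B} and {B : e ∉ B} are complementary halfspaces.  If none of them separates
-- a nonempty convex A from x, then for every e some member of A agrees with x at e.  Then
-- for a ∈ A ∖ {x} and an exchange a - f + g towards x, A contains a - f + g′ (exchange
-- towards a member missing f) and some a - h + g (move a member containing g towards a
-- until only g is left to add), and a - f + g lies between these two.  So A contains x.

open import Data.Nat using (ℕ; zero; suc; _+_; _*_; _≤_; _<_; z≤n; z<s)
open import Data.Nat.Properties
  using ( +-0-commutativeMonoid; +-commutativeSemigroup; +-comm; +-assoc; +-identityʳ
        ; +-mono-≤; +-monoʳ-≤; +-cancelˡ-≡; +-cancelʳ-≡; +-cancelʳ-≤; *-suc; *-distribˡ-+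
        ; *-cancelˡ-≡; *-cancelˡ-≤; m<m+n; ≤-refl; ≤-reflexive; ≤-trans; ≤-antisym; ≤-total
        ; module ≤-Reasoning )
open import Data.Nat.Induction using (<-wellFounded)
open import Algebra.Properties.CommutativeMonoid.Sum +-0-commutativeMonoid
  using (sum-syntax; ∑-distrib-+; sum-cong-≗; sum-replicate-zero)
open import Algebra.Properties.CommutativeSemigroup +-commutativeSemigroup
  using (xy∙z≈zy∙x; xy∙z≈xz∙y)
open import Data.Bool using (Bool; true; false; T; not; _xor_; if_then_else_)
open import Data.Bool.Properties
  using (∨-zeroʳ; ∨-identityʳ; ¬-not; T-irrelevant; xor-same) renaming (_≟_ to _≟ᵇ_)
open import Data.Fin using (Fin; zero; suc; _≟_)
open import Data.Fin.Properties using (any?; all?; ¬∀⟶∃¬)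
open import Data.Fin.Subset using (Subset; _∉_; _∪_; _-_; ⁅_⁆; ∣_∣)
open import Data.Fin.Subset.Properties using (p─⊥≡p; ∪-identityʳ; anySubset?)
open import Data.Vec using ([]; _∷_; lookup; tabulate; _[_]≔_)
open import Data.Vec.Properties
  using (lookup∘update; lookup∘update′; tabulate∘lookup; tabulate-cong; []=⇒lookup; lookup⇒[]=)
open import Data.Product using (Σ; ∃; _×_; _,_; proj₁; proj₂)
open import Data.Sum using (_⊎_; inj₁; inj₂)
open import Data.Unit using (tt)
open import Data.Empty using (⊥-elim)
open import Function using (_∘_)
open import Induction.WellFounded using (Acc; acc)
open import Relation.Nullary using (Dec; yes; no; ¬_; ¬?; _×-dec_)
open import Relation.Nullary.Decidable using (map′; decidable-stable; T?)
open import Relation.Binary.PropositionalEquality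
open import Defs

∑-mono-≤ : ∀ {m} {f g : Fin m → ℕ} → (∀ i → f i ≤ g i) → ∑[ i < m ] f i ≤ ∑[ i < m ] g i
∑-mono-≤ {zero}  f≤g = z≤n
∑-mono-≤ {suc m} f≤g = +-mono-≤ (f≤g zero) (∑-mono-≤ (f≤g ∘ suc))

+-tight : ∀ {a b c d} → a ≤ c → b ≤ d → a + b ≡ c + d → a ≡ c × b ≡ d
+-tight {a} {b} {c} {d} a≤c b≤d eq = a≡c , +-cancelˡ-≡ a b d (trans eq (cong (_+ d) (sym a≡c)))
  where
  a≡c : a ≡ c
  a≡c = ≤-antisym a≤c (+-cancelʳ-≤ b c a (≤-trans (+-monoʳ-≤ c b≤d) (≤-reflexive (sym eq))))

∑-tight : ∀ {m} {f g : Fin m → ℕ} → (∀ i → f i ≤ g i) →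
          ∑[ i < m ] f i ≡ ∑[ i < m ] g i → ∀ i → f i ≡ g i
∑-tight {suc m} f≤g eq i with +-tight (f≤g zero) (∑-mono-≤ (f≤g ∘ suc)) eq | i
... | f₀≡g₀ , _     | zero  = f₀≡g₀
... | _     , rest≡ | suc j = ∑-tight (f≤g ∘ suc) rest≡ j

T-not⇒¬T : ∀ {b} → T (not b) → ¬ T b
T-not⇒¬T {true}  () _
T-not⇒¬T {false} _ ()

≢⇒T-xor : ∀ {x y} → x ≢ y → T (x xor y)
≢⇒T-xor {true}  {false} _ = tt
≢⇒T-xor {false} {true}  _ = tt
≢⇒T-xor {true}  {true}  x≢y = x≢y refl
≢⇒T-xor {false} {false} x≢y = x≢y refl

-- Hamming distance and metric intervals of subsets

bitDist : Bool → Bool → ℕ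
bitDist x y = if x xor y then 1 else 0

bitDist-self : ∀ x → bitDist x x ≡ 0
bitDist-self true  = refl
bitDist-self false = refl

bitDist-sym : ∀ x y → bitDist x y ≡ bitDist y x
bitDist-sym true  true  = refl
bitDist-sym true  false = refl
bitDist-sym false true  = refl
bitDist-sym false false = refl

bitDist-triangle : ∀ x y z → bitDist x z ≤ bitDist x y + bitDist y z
bitDist-triangle true  true  z     = ≤-refl
bitDist-triangle false false z     = ≤-refl
bitDist-triangle true  false true  = z≤n
bitDist-triangle true  false false = ≤-refl
bitDist-triangle false true  true  = ≤-refl
bitDist-triangle false true  false = z≤n

bitDist-≤1 : ∀ x y → bitDist x y ≤ 1
bitDist-≤1 x y with x xor y
... | true  = ≤-refl
... | false = z≤n

Betweenᵇ : Bool → Bool → Bool → Set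
Betweenᵇ x y z = bitDist x z + bitDist z y ≡ bitDist x y

betweenᵇ⇒endpoint : ∀ x y z → Betweenᵇ x y z → z ≡ x ⊎ z ≡ y
betweenᵇ⇒endpoint true  _     true  _ = inj₁ refl
betweenᵇ⇒endpoint false _     false _ = inj₁ refl
betweenᵇ⇒endpoint true  false false _ = inj₂ refl
betweenᵇ⇒endpoint false true  true  _ = inj₂ refl

endpoints-agree⇒betweenᵇ : ∀ {x y z} → (x ≡ y → z ≡ x) → Betweenᵇ x y z
endpoints-agree⇒betweenᵇ {true}  {false} {true}  _ = refl
endpoints-agree⇒betweenᵇ {true}  {false} {false} _ = refl
endpoints-agree⇒betweenᵇ {false} {true}  {true}  _ = refl
endpoints-agree⇒betweenᵇ {false} {true}  {false} _ = refl
endpoints-agree⇒betweenᵇ {true}  {true}  z≡x rewrite z≡x refl = refl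
endpoints-agree⇒betweenᵇ {false} {false} z≡x rewrite z≡x refl = refl

betweenᵇ-bitDist-≤ : ∀ v w x y → Betweenᵇ v w x → Betweenᵇ v w y → bitDist x y ≤ bitDist v w
betweenᵇ-bitDist-≤ true  false x     y     _ _ = bitDist-≤1 x y
betweenᵇ-bitDist-≤ false true  x     y     _ _ = bitDist-≤1 x y
betweenᵇ-bitDist-≤ true  true  true  true  _ _ = z≤n
betweenᵇ-bitDist-≤ false false false false _ _ = z≤n

opposite-bits : ∀ v w x y → Betweenᵇ v w x → Betweenᵇ v w y → bitDist x y ≡ bitDist v w →
                ∀ u → bitDist u x + bitDist u y ≡ bitDist u v + bitDist u w
opposite-bits true  true  true  true  _ _ _ u = refl
opposite-bits false false false false _ _ _ u = refl
opposite-bits true  false true  false _ _ _ u = refl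
opposite-bits false true  false true  _ _ _ u = refl
opposite-bits true  false false true  _ _ _ u = +-comm (bitDist u false) (bitDist u true)
opposite-bits false true  true  false _ _ _ u = +-comm (bitDist u true) (bitDist u false)

coordDist : ∀ {n} → Subset n → Subset n → Fin n → ℕ
coordDist s t i = bitDist (lookup s i) (lookup t i)

hamming : ∀ {n} → Subset n → Subset n → ℕ
hamming {n} s t = ∑[ i < n ] coordDist s t i

∣△∣≡hamming : ∀ {n} (s t : Subset n) → ∣ s △ t ∣ ≡ hamming s t
∣△∣≡hamming []          []          = refl
∣△∣≡hamming (true  ∷ s) (true  ∷ t) = ∣△∣≡hamming s t
∣△∣≡hamming (true  ∷ s) (false ∷ t) = cong suc (∣△∣≡hamming s t)
∣△∣≡hamming (false ∷ s) (true  ∷ t) = cong suc (∣△∣≡hamming s t)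
∣△∣≡hamming (false ∷ s) (false ∷ t) = ∣△∣≡hamming s t

hamming-self : ∀ {n} (s : Subset n) → hamming s s ≡ 0
hamming-self {n} s = trans (sum-cong-≗ (bitDist-self ∘ lookup s)) (sum-replicate-zero n)

hamming-sym : ∀ {n} (s t : Subset n) → hamming s t ≡ hamming t s
hamming-sym s t = sum-cong-≗ (λ i → bitDist-sym (lookup s i) (lookup t i))

hamming-triangle : ∀ {n} (s t u : Subset n) → hamming s u ≤ hamming s t + hamming t u
hamming-triangle s t u = ≤-trans
  (∑-mono-≤ (λ i → bitDist-triangle (lookup s i) (lookup t i) (lookup u i)))
  (≤-reflexive (∑-distrib-+ (coordDist s t) (coordDist t u)))

lookup-ext : ∀ {n} {s t : Subset n} → (∀ i → lookup s i ≡ lookup t i) → s ≡ t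
lookup-ext {s = s} {t} s≗t = begin
  s                   ≡⟨ tabulate∘lookup s ⟨
  tabulate (lookup s) ≡⟨ tabulate-cong s≗t ⟩
  tabulate (lookup t) ≡⟨ tabulate∘lookup t ⟩
  t                   ∎
  where open ≡-Reasoning

≡⊎differ : ∀ {n} (s t : Subset n) → s ≡ t ⊎ ∃ λ i → lookup s i ≢ lookup t i
≡⊎differ {n} s t with all? (λ i → lookup s i ≟ᵇ lookup t i)
... | yes s≗t = inj₁ (lookup-ext s≗t)
... | no s≭t  = inj₂ (¬∀⟶∃¬ n _ (λ i → lookup s i ≟ᵇ lookup t i) s≭t)

Between : ∀ {n} → Subset n → Subset n → Subset n → Set
Between u v w = ∀ i → Betweenᵇ (lookup u i) (lookup v i) (lookup w i)

between⇒hamming : ∀ {n} (u v w : Subset n) → Between u v w → hamming u w + hamming w v ≡ hamming u v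
between⇒hamming u v w w∈uv =
  trans (sym (∑-distrib-+ (coordDist u w) (coordDist w v))) (sum-cong-≗ w∈uv)

hamming⇒between : ∀ {n} (u v w : Subset n) → hamming u w + hamming w v ≡ hamming u v → Between u v w
hamming⇒between u v w eq i = sym (∑-tight
  (λ j → bitDist-triangle (lookup u j) (lookup w j) (lookup v j))
  (trans (sym eq) (sym (∑-distrib-+ (coordDist u w) (coordDist w v)))) i)

hamming-opposite : ∀ {n} (v w x y : Subset n) → Between v w x → Between v w y →
                   hamming x y ≡ hamming v w →
                   ∀ u → hamming u x + hamming u y ≡ hamming u v + hamming u w
hamming-opposite {n} v w x y x∈vw y∈vw xy≡vw u = begin
  hamming u x + hamming u y                      ≡⟨ ∑-distrib-+ (coordDist u x) (coordDist u y) ⟨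
  ∑[ i < n ] (coordDist u x i + coordDist u y i) ≡⟨ sum-cong-≗ opposite-at ⟩
  ∑[ i < n ] (coordDist u v i + coordDist u w i) ≡⟨ ∑-distrib-+ (coordDist u v) (coordDist u w) ⟩
  hamming u v + hamming u w                      ∎
  where
  open ≡-Reasoning
  xy≗vw : ∀ i → coordDist x y i ≡ coordDist v w i
  xy≗vw = ∑-tight
    (λ i → betweenᵇ-bitDist-≤ (lookup v i) (lookup w i) (lookup x i) (lookup y i) (x∈vw i) (y∈vw i))
    xy≡vw
  opposite-at : ∀ i → coordDist u x i + coordDist u y i ≡ coordDist u v i + coordDist u w i
  opposite-at i = opposite-bits (lookup v i) (lookup w i) (lookup x i) (lookup y i)
    (x∈vw i) (y∈vw i) (xy≗vw i) (lookup u i)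

hamming-update : ∀ {n} (s t : Subset n) i x →
                 hamming (s [ i ]≔ x) t + coordDist s t i ≡ hamming s t + bitDist x (lookup t i)
hamming-update (y ∷ s) (z ∷ t) zero    x = xy∙z≈zy∙x (bitDist x z) (hamming s t) (bitDist y z)
hamming-update (y ∷ s) (z ∷ t) (suc i) x = begin
  bitDist y z + hamming (s [ i ]≔ x) t + coordDist s t i
    ≡⟨ +-assoc (bitDist y z) _ _ ⟩
  bitDist y z + (hamming (s [ i ]≔ x) t + coordDist s t i)
    ≡⟨ cong (bitDist y z +_) (hamming-update s t i x) ⟩
  bitDist y z + (hamming s t + bitDist x (lookup t i))
    ≡⟨ +-assoc (bitDist y z) _ _ ⟨
  bitDist y z + hamming s t + bitDist x (lookup t i)
    ∎
  where open ≡-Reasoning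

-- Single-element exchanges

replace : ∀ {n} → Subset n → Fin n → Fin n → Subset n
replace A e f = (A - e) ∪ ⁅ f ⁆

-≡[]≔false : ∀ {n} (A : Subset n) e → A - e ≡ A [ e ]≔ false
-≡[]≔false (x ∷ A) zero    = cong (false ∷_) (p─⊥≡p A)
-≡[]≔false (x ∷ A) (suc e) = cong (x ∷_) (-≡[]≔false A e)

∪⁅⁆≡[]≔true : ∀ {n} (A : Subset n) f → A ∪ ⁅ f ⁆ ≡ A [ f ]≔ true
∪⁅⁆≡[]≔true (x ∷ A) zero    = cong₂ _∷_ (∨-zeroʳ x) (∪-identityʳ A)
∪⁅⁆≡[]≔true (x ∷ A) (suc f) = cong₂ _∷_ (∨-identityʳ x) (∪⁅⁆≡[]≔true A f)

replace≡updates : ∀ {n} (A : Subset n) e f → replace A e f ≡ A [ e ]≔ false [ f ]≔ true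
replace≡updates A e f = trans (∪⁅⁆≡[]≔true (A - e) f) (cong (_[ f ]≔ true) (-≡[]≔false A e))

replace-added : ∀ {n} (A : Subset n) e f → lookup (replace A e f) f ≡ true
replace-added A e f rewrite replace≡updates A e f = lookup∘update f (A [ e ]≔ false) true

replace-removed : ∀ {n} (A : Subset n) {e f} → e ≢ f → lookup (replace A e f) e ≡ false
replace-removed A {e} {f} e≢f rewrite replace≡updates A e f =
  trans (lookup∘update′ e≢f (A [ e ]≔ false) true) (lookup∘update e A false)

replace-kept : ∀ {n} (A : Subset n) {e f i} → i ≢ e → i ≢ f → lookup (replace A e f) i ≡ lookup A i
replace-kept A {e} {f} i≢e i≢f rewrite replace≡updates A e f =
  trans (lookup∘update′ i≢f (A [ e ]≔ false) true) (lookup∘update′ i≢e A false)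

∉⇒lookup : ∀ {n} {A : Subset n} {e} → e ∉ A → lookup A e ≡ false
∉⇒lookup {A = A} {e} e∉A = ¬-not (e∉A ∘ lookup⇒[]= e A)

lookup⇒∉ : ∀ {n} {A : Subset n} {e} → lookup A e ≡ false → e ∉ A
lookup⇒∉ A[e] e∈A with () ← trans (sym ([]=⇒lookup e∈A)) A[e]

∈∉⇒≢ : ∀ {n} (A : Subset n) {e f} → lookup A e ≡ true → lookup A f ≡ false → e ≢ f
∈∉⇒≢ A A[e] A[f] refl with () ← trans (sym A[e]) A[f]

-- The bits are parameters so that callers instantiating them get numerals on both sides.
hamming-replace : ∀ {n} (s t : Subset n) {e f} {se sf te tf : Bool} → e ≢ f →
                  lookup s e ≡ se → lookup s f ≡ sf → lookup t e ≡ te → lookup t f ≡ tf →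
                  hamming (replace s e f) t + bitDist sf tf + bitDist se te ≡
                  hamming s t + bitDist true tf + bitDist false te
hamming-replace s t {e} {f} e≢f refl refl refl refl = begin
  hamming (replace s e f) t + coordDist s t f + coordDist s t e
    ≡⟨ cong₂ (λ u c → hamming u t + c + coordDist s t e) (replace≡updates s e f) (sym s₁≗s-at-f) ⟩
  hamming (s₁ [ f ]≔ true) t + coordDist s₁ t f + coordDist s t e
    ≡⟨ cong (_+ coordDist s t e) (hamming-update s₁ t f true) ⟩
  hamming s₁ t + bitDist true (lookup t f) + coordDist s t e
    ≡⟨ xy∙z≈xz∙y (hamming s₁ t) _ _ ⟩
  hamming s₁ t + coordDist s t e + bitDist true (lookup t f)
    ≡⟨ cong (_+ bitDist true (lookup t f)) (hamming-update s t e false) ⟩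
  hamming s t + bitDist false (lookup t e) + bitDist true (lookup t f)
    ≡⟨ xy∙z≈xz∙y (hamming s t) _ _ ⟩
  hamming s t + bitDist true (lookup t f) + bitDist false (lookup t e) ∎
  where
  open ≡-Reasoning
  s₁ = s [ e ]≔ false
  s₁≗s-at-f : coordDist s₁ t f ≡ coordDist s t f
  s₁≗s-at-f = cong (λ b → bitDist b (lookup t f)) (lookup∘update′ (e≢f ∘ sym) s false)

hamming-replace-closer : ∀ {n} (s t : Subset n) {e f} →
                         lookup s e ≡ true → lookup t e ≡ false →
                         lookup s f ≡ false → lookup t f ≡ true →
                         hamming (replace s e f) t + 2 ≡ hamming s t
hamming-replace-closer s t {e} {f} s[e] t[e] s[f] t[f] = begin
  hamming (replace s e f) t + 2     ≡⟨ +-assoc (hamming (replace s e f) t) 1 1 ⟨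
  hamming (replace s e f) t + 1 + 1 ≡⟨ hamming-replace s t (∈∉⇒≢ s s[e] s[f]) s[e] s[f] t[e] t[f] ⟩
  hamming s t + 0 + 0               ≡⟨ trans (+-identityʳ _) (+-identityʳ _) ⟩
  hamming s t                       ∎
  where open ≡-Reasoning

hamming-replace-farther : ∀ {n} (s t : Subset n) {e f} →
                          lookup s e ≡ true → lookup t e ≡ true →
                          lookup s f ≡ false → lookup t f ≡ false →
                          hamming (replace s e f) t ≡ hamming s t + 2
hamming-replace-farther s t {e} {f} s[e] t[e] s[f] t[f] = begin
  hamming (replace s e f) t         ≡⟨ trans (+-identityʳ _) (+-identityʳ _) ⟨
  hamming (replace s e f) t + 0 + 0 ≡⟨ hamming-replace s t (∈∉⇒≢ s s[e] s[f]) s[e] s[f] t[e] t[f] ⟩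
  hamming s t + 1 + 1               ≡⟨ +-assoc (hamming s t) 1 1 ⟩
  hamming s t + 2                   ∎
  where open ≡-Reasoning

hamming-replace-self : ∀ {n} (s : Subset n) {e f} → lookup s e ≡ true → lookup s f ≡ false →
                       hamming s (replace s e f) ≡ 2
hamming-replace-self s {e} {f} s[e] s[f] = begin
  hamming s (replace s e f) ≡⟨ hamming-sym s (replace s e f) ⟩
  hamming (replace s e f) s ≡⟨ hamming-replace-farther s s s[e] s[e] s[f] s[f] ⟩
  hamming s s + 2           ≡⟨ cong (_+ 2) (hamming-self s) ⟩
  2                         ∎
  where open ≡-Reasoning

replace-between : ∀ {n} (s t : Subset n) {e f} →
                  lookup s e ≡ true → lookup t e ≡ false → lookup s f ≡ false → lookup t f ≡ true →
                  Between s t (replace s e f)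
replace-between s t {e} {f} s[e] t[e] s[f] t[f] = hamming⇒between s t (replace s e f) (trans
  (cong₂ _+_ (hamming-replace-self s s[e] s[f]) refl)
  (trans (+-comm 2 _) (hamming-replace-closer s t s[e] t[e] s[f] t[f])))

replace-between-replacements : ∀ {n} (A : Subset n) {f h g g′} →
  lookup A f ≡ true → lookup A h ≡ true → lookup A g ≡ false → lookup A g′ ≡ false →
  Between (replace A h g) (replace A f g′) (replace A f g)
replace-between-replacements A {f} {h} {g} {g′} A[f] A[h] A[g] A[g′] i =
  endpoints-agree⇒betweenᵇ agree
  where
  f≢g  = ∈∉⇒≢ A A[f] A[g]
  f≢g′ = ∈∉⇒≢ A A[f] A[g′]
  h≢g  = ∈∉⇒≢ A A[h] A[g]
  h≢g′ = ∈∉⇒≢ A A[h] A[g′]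
  agree : lookup (replace A h g) i ≡ lookup (replace A f g′) i →
          lookup (replace A f g) i ≡ lookup (replace A h g) i
  agree p≡q with i ≟ g | i ≟ f | i ≟ h
  ... | yes refl | _        | _        = trans (replace-added A f i) (sym (replace-added A h i))
  ... | no _     | yes refl | _        =
    trans (replace-removed A f≢g) (sym (trans p≡q (replace-removed A f≢g′)))
  ... | no _     | no i≢f   | yes refl
    with () ← trans (sym (replace-removed A h≢g)) (trans p≡q (trans (replace-kept A i≢f h≢g′) A[h]))
  ... | no i≢g   | no i≢f   | no i≢h   =
    trans (replace-kept A i≢f i≢g) (sym (replace-kept A i≢h i≢g))

-- The basis graph

module BasisGraph {n : ℕ} (M : Matroid n) where
  open Matroid M
  open GraphNotions (BasisAdj M)

  ⟦_⟧ : Basis M → Subset n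
  ⟦_⟧ = proj₁

  _!_ : Basis M → Fin n → Bool
  u ! i = lookup ⟦ u ⟧ i

  δ : Basis M → Basis M → ℕ
  δ u v = hamming ⟦ u ⟧ ⟦ v ⟧

  basis-ext : ∀ {u v : Basis M} → ⟦ u ⟧ ≡ ⟦ v ⟧ → u ≡ v
  basis-ext {s , p} {.s , q} refl = cong (s ,_) (T-irrelevant p q)

  δ≡2⇒adjacent : ∀ u v → δ u v ≡ 2 → BasisAdj M u v
  δ≡2⇒adjacent u v = trans (∣△∣≡hamming ⟦ u ⟧ ⟦ v ⟧)

  adjacent⇒δ≡2 : ∀ u v → BasisAdj M u v → δ u v ≡ 2
  adjacent⇒δ≡2 u v = trans (sym (∣△∣≡hamming ⟦ u ⟧ ⟦ v ⟧))

  adjacent-sym : ∀ u v → BasisAdj M u v → BasisAdj M v u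
  adjacent-sym u v u~v = δ≡2⇒adjacent v u (trans (hamming-sym ⟦ v ⟧ ⟦ u ⟧) (adjacent⇒δ≡2 u v u~v))

  record Exchange (u v : Basis M) : Set where
    field
      leaving entering : Fin n
      leaving∈u  : u ! leaving ≡ true
      leaving∉v  : v ! leaving ≡ false
      entering∈v : v ! entering ≡ true
      entering∉u : u ! entering ≡ false
      isBasis    : T (IsBasis (replace ⟦ u ⟧ leaving entering))

    result : Basis M
    result = replace ⟦ u ⟧ leaving entering , isBasis

    result-adjacent : BasisAdj M u result
    result-adjacent = δ≡2⇒adjacent u result (hamming-replace-self ⟦ u ⟧ leaving∈u entering∉u)

    result-closer : δ result v + 2 ≡ δ u v
    result-closer = hamming-replace-closer ⟦ u ⟧ ⟦ v ⟧ leaving∈u leaving∉v entering∉u entering∈v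

    result-< : δ result v < δ u v
    result-< = ≤-trans (m<m+n (δ result v) z<s) (≤-reflexive result-closer)

    result-between : Between ⟦ u ⟧ ⟦ v ⟧ ⟦ result ⟧
    result-between = replace-between ⟦ u ⟧ ⟦ v ⟧ leaving∈u leaving∉v entering∉u entering∈v

  open Exchange

  exchange-at : ∀ u v {e} → u ! e ≡ true → v ! e ≡ false → Exchange u v
  exchange-at u v {e} u[e] v[e] =
    let f , f∈v , f∉u , basis =
          exchange ⟦ u ⟧ ⟦ v ⟧ (proj₂ u) (proj₂ v) e (lookup⇒[]= e ⟦ u ⟧ u[e]) (lookup⇒∉ v[e])
    in record
      { leaving    = e
      ; entering   = f
      ; leaving∈u  = u[e]
      ; leaving∉v  = v[e]
      ; entering∈v = []=⇒lookup f∈v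
      ; entering∉u = ∉⇒lookup f∉u
      ; isBasis    = basis
      }

  ≡⊎Exchange : ∀ u v → u ≡ v ⊎ Exchange u v
  ≡⊎Exchange u v with ≡⊎differ ⟦ u ⟧ ⟦ v ⟧
  ... | inj₁ u≡v = inj₁ (basis-ext u≡v)
  ... | inj₂ (i , u≢v-at-i) with u ! i in u[i] | v ! i in v[i]
  ...   | true  | true  = ⊥-elim (u≢v-at-i refl)
  ...   | false | false = ⊥-elim (u≢v-at-i refl)
  ...   | true  | false = inj₂ (exchange-at u v u[i] v[i])
  ...   | false | true  = inj₂ (exchange-at u v (entering∈v s) (entering∉u s))
    where s = exchange-at v u v[i] u[i]

  walk⇒δ≤ : ∀ {u v k} → Walk u v k → δ u v ≤ 2 * k
  walk⇒δ≤ {u} here = ≤-reflexive (hamming-self ⟦ u ⟧)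
  walk⇒δ≤ {u} {w} (step {v = v} {k = k} u~v v⇝w) = begin
    δ u w         ≤⟨ hamming-triangle ⟦ u ⟧ ⟦ v ⟧ ⟦ w ⟧ ⟩
    δ u v + δ v w ≤⟨ +-mono-≤ (≤-reflexive (adjacent⇒δ≡2 u v u~v)) (walk⇒δ≤ v⇝w) ⟩
    2 + 2 * k     ≡⟨ *-suc 2 k ⟨
    2 * suc k     ∎
    where open ≤-Reasoning

  walk-of-length-δ/2 : ∀ u v → Acc _<_ (δ u v) → ∃ λ k → 2 * k ≡ δ u v × Walk u v k
  walk-of-length-δ/2 u v (acc rs) with ≡⊎Exchange u v
  ... | inj₁ refl = 0 , sym (hamming-self ⟦ u ⟧) , here
  ... | inj₂ s with walk-of-length-δ/2 (result s) v (rs (result-< s))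
  ...   | k , 2k≡δ , s⇝v = suc k , 2[1+k]≡δ , step (result-adjacent s) s⇝v
    where
    2[1+k]≡δ : 2 * suc k ≡ δ u v
    2[1+k]≡δ = trans (*-suc 2 k) (trans (cong (2 +_) 2k≡δ) (trans (+-comm 2 _) (result-closer s)))

  geodesic : ∀ u v → ∃ λ k → 2 * k ≡ δ u v × Walk u v k
  geodesic u v = walk-of-length-δ/2 u v (<-wellFounded (δ u v))

  dist⇒δ : ∀ {u v k} → Dist u v k → 2 * k ≡ δ u v
  dist⇒δ {u} {v} {k} (u⇝v , shortest) with geodesic u v
  ... | k′ , 2k′≡δ , u⇝′v = trans (cong (2 *_) k≡k′) 2k′≡δ
    where
    k≡k′ : k ≡ k′
    k≡k′ = ≤-antisym (shortest k′ u⇝′v) (*-cancelˡ-≤ 2 (subst (_≤ 2 * k) (sym 2k′≡δ) (walk⇒δ≤ u⇝v)))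

  δ⇒dist : ∀ {u v k} → 2 * k ≡ δ u v → Dist u v k
  δ⇒dist {u} {v} {k} 2k≡δ with geodesic u v
  ... | k′ , 2k′≡δ , u⇝v =
    subst (Walk u v) (*-cancelˡ-≡ k′ k 2 (trans 2k′≡δ (sym 2k≡δ))) u⇝v ,
    λ m u⇝ᵐv → *-cancelˡ-≤ 2 (subst (_≤ 2 * m) (sym 2k≡δ) (walk⇒δ≤ u⇝ᵐv))

  interval⇒between : ∀ {u v w} → InInterval u v w → Between ⟦ u ⟧ ⟦ v ⟧ ⟦ w ⟧
  interval⇒between {u} {v} {w} (a , b , uw , wv , uv) = hamming⇒between ⟦ u ⟧ ⟦ v ⟧ ⟦ w ⟧ (begin
    δ u w + δ w v ≡⟨ cong₂ _+_ (dist⇒δ uw) (dist⇒δ wv) ⟨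
    2 * a + 2 * b ≡⟨ *-distribˡ-+ 2 a b ⟨
    2 * (a + b)   ≡⟨ dist⇒δ uv ⟩
    δ u v         ∎)
    where open ≡-Reasoning

  between⇒interval : ∀ {u v w} → Between ⟦ u ⟧ ⟦ v ⟧ ⟦ w ⟧ → InInterval u v w
  between⇒interval {u} {v} {w} w∈uv with geodesic u w | geodesic w v
  ... | a , 2a≡δ , _ | b , 2b≡δ , _ = a , b , δ⇒dist 2a≡δ , δ⇒dist 2b≡δ , δ⇒dist (begin
    2 * (a + b)   ≡⟨ *-distribˡ-+ 2 a b ⟩
    2 * a + 2 * b ≡⟨ cong₂ _+_ 2a≡δ 2b≡δ ⟩
    δ u w + δ w v ≡⟨ between⇒hamming ⟦ u ⟧ ⟦ v ⟧ ⟦ w ⟧ w∈uv ⟩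
    δ u v         ∎)
    where open ≡-Reasoning

  connected : Connected
  connected u v = let k , _ , u⇝v = geodesic u v in k , u⇝v

  exchange-common-neighbour : ∀ {u v} (s : Exchange u v) → δ u v ≡ 4 →
                              BasisAdj M u (result s) × BasisAdj M (result s) v
  exchange-common-neighbour {u} {v} s δ≡4 =
    result-adjacent s , δ≡2⇒adjacent (result s) v (+-cancelʳ-≡ 2 _ 2 (trans (result-closer s) δ≡4))

  common-neighbour-between : ∀ v w x → δ v w ≡ 4 → BasisAdj M v x → BasisAdj M x w →
                             Between ⟦ v ⟧ ⟦ w ⟧ ⟦ x ⟧
  common-neighbour-between v w x δ≡4 v~x x~w = hamming⇒between ⟦ v ⟧ ⟦ w ⟧ ⟦ x ⟧
    (trans (cong₂ _+_ (adjacent⇒δ≡2 v x v~x) (adjacent⇒δ≡2 x w x~w)) (sym δ≡4))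

  record Square (v w : Basis M) : Set where
    field
      x y      : Basis M
      v~x      : BasisAdj M v x
      x~w      : BasisAdj M x w
      v~y      : BasisAdj M v y
      y~w      : BasisAdj M y w
      diagonal : δ x y ≡ 4

  square-from-neighbour : ∀ {v w} (s : Exchange v w) → δ v w ≡ 4 →
                          ∀ y → BasisAdj M v y → BasisAdj M y w →
                y ! leaving s ≡ true → y ! entering s ≡ false → Square v w
  square-from-neighbour {v} {w} s δ≡4 y v~y y~w y[e] y[f] = record
    { x = result s ; y = y
    ; v~x = proj₁ (exchange-common-neighbour s δ≡4)
    ; x~w = proj₂ (exchange-common-neighbour s δ≡4)
    ; v~y = v~y ; y~w = y~w
    ; diagonal = trans (hamming-replace-farther ⟦ v ⟧ ⟦ y ⟧ (leaving∈u s) y[e] (entering∉u s) y[f])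
                       (cong (_+ 2) (adjacent⇒δ≡2 v y v~y))
    }

  -- For the exchanges s = v - p + f₁, t = w - f₁ + e₁ and s′ = v - e₁ + f₂ below, the
  -- square consists of the results of s and t if e₁ = p, of s′ and t if f₂ = f₁, and of
  -- s and s′ otherwise.
  square-from-exchange : ∀ {v w} (s : Exchange v w) → δ v w ≡ 4 → Square v w
  square-from-exchange {v} {w} s δ≡4 = by-cases (entering t ≟ leaving s) (entering s′ ≟ entering s)
    where
    t : Exchange w v
    t = exchange-at w v (entering∈v s) (entering∉u s)
    s′ : Exchange v w
    s′ = exchange-at v w (entering∈v t) (entering∉u t)
    y z : Basis M
    y = result t
    z = result s′
    w~y×y~v = exchange-common-neighbour t (trans (hamming-sym ⟦ w ⟧ ⟦ v ⟧) δ≡4)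
    v~z×z~w = exchange-common-neighbour s′ δ≡4
    v~y = adjacent-sym y v (proj₂ w~y×y~v)
    y~w = adjacent-sym w y (proj₁ w~y×y~v)
    f₁≢e₁ : entering s ≢ entering t
    f₁≢e₁ = ∈∉⇒≢ ⟦ w ⟧ (entering∈v s) (entering∉u t)
    p≢f₂ : leaving s ≢ entering s′
    p≢f₂ = ∈∉⇒≢ ⟦ v ⟧ (leaving∈u s) (entering∉u s′)
    y[e₁] : y ! entering t ≡ true
    y[e₁] = replace-added ⟦ w ⟧ (leaving t) (entering t)
    y[f₁] : y ! entering s ≡ false
    y[f₁] = replace-removed ⟦ w ⟧ f₁≢e₁

    by-cases : Dec (entering t ≡ leaving s) → Dec (entering s′ ≡ entering s) → Square v w
    by-cases (yes e₁≡p) _ =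
      square-from-neighbour s δ≡4 y v~y y~w (subst (λ i → y ! i ≡ true) e₁≡p y[e₁]) y[f₁]
    by-cases (no _) (yes f₂≡f₁) =
      square-from-neighbour s′ δ≡4 y v~y y~w y[e₁] (subst (λ i → y ! i ≡ false) (sym f₂≡f₁) y[f₁])
    by-cases (no e₁≢p) (no f₂≢f₁) = square-from-neighbour s δ≡4 z (proj₁ v~z×z~w) (proj₂ v~z×z~w)
      (trans (replace-kept ⟦ v ⟧ (e₁≢p ∘ sym) p≢f₂) (leaving∈u s))
      (trans (replace-kept ⟦ v ⟧ f₁≢e₁ (f₂≢f₁ ∘ sym)) (entering∉u s))

  square : ∀ v w → δ v w ≡ 4 → Square v w
  square v w δ≡4 with ≡⊎Exchange v w
  ... | inj₁ refl with () ← trans (sym (hamming-self ⟦ v ⟧)) δ≡4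
  ... | inj₂ s = square-from-exchange s δ≡4

  nearer-neighbour-bound : ∀ {u v w x} y → δ u x ≤ δ u y → δ u x + δ u y ≡ δ u v + δ u w →
                           ∀ a b c → Dist u v a → Dist u w b → Dist u x c → 2 * c ≤ a + b
  nearer-neighbour-bound {u} {v} {w} {x} y x≤y sum≡ a b c uv uw ux = *-cancelˡ-≤ 2 (begin
    2 * (2 * c)   ≡⟨ cong (2 *_) (dist⇒δ ux) ⟩
    2 * δ u x     ≡⟨ cong (δ u x +_) (+-identityʳ (δ u x)) ⟩
    δ u x + δ u x ≤⟨ +-monoʳ-≤ (δ u x) x≤y ⟩
    δ u x + δ u y ≡⟨ sum≡ ⟩
    δ u v + δ u w ≡⟨ cong₂ _+_ (dist⇒δ uv) (dist⇒δ uw) ⟨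
    2 * a + 2 * b ≡⟨ *-distribˡ-+ 2 a b ⟨
    2 * (a + b)   ∎)
    where open ≤-Reasoning

  meshed : Meshed
  meshed u v w v⇝²w = nearer (≤-total (δ u x) (δ u y))
    where
    δ≡4 : δ v w ≡ 4
    δ≡4 = sym (dist⇒δ v⇝²w)
    open Square (square v w δ≡4)
    sum≡ : δ u x + δ u y ≡ δ u v + δ u w
    sum≡ = hamming-opposite ⟦ v ⟧ ⟦ w ⟧ ⟦ x ⟧ ⟦ y ⟧
      (common-neighbour-between v w x δ≡4 v~x x~w) (common-neighbour-between v w y δ≡4 v~y y~w)
      (trans diagonal (sym δ≡4)) ⟦ u ⟧
    nearer : δ u x ≤ δ u y ⊎ δ u y ≤ δ u x → _
    nearer (inj₁ x≤y) = x , v~x , x~w , nearer-neighbour-bound y x≤y sum≡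
    nearer (inj₂ y≤x) =
      y , v~y , y~w , nearer-neighbour-bound x y≤x (trans (+-comm (δ u y) (δ u x)) sum≡)

  coordinate-convex : ∀ e (φ : Bool → Bool) → Convex (λ y → φ (y ! e))
  coordinate-convex e φ u v w φu φv w∈uv
    with betweenᵇ⇒endpoint (u ! e) (v ! e) (w ! e) (interval⇒between w∈uv e)
  ... | inj₁ w≡u = subst (T ∘ φ) (sym w≡u) φu
  ... | inj₂ w≡v = subst (T ∘ φ) (sym w≡v) φv

  any-basis? : {P : Basis M → Set} → (∀ a → Dec (P a)) → Dec (∃ P)
  any-basis? {P} P? = map′ (λ (s , b , p) → (s , b) , p) (λ ((s , b) , p) → s , b , p)
    (anySubset? (λ s → Σ-T? (λ b → P? (s , b))))
    where
    Σ-T? : ∀ {b} {Q : T b → Set} → (∀ t → Dec (Q t)) → Dec (Σ (T b) Q)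
    Σ-T? {false} Q? = no proj₁
    Σ-T? {true}  Q? = map′ (tt ,_) proj₂ (Q? tt)

  module Separation (A : Basis M → Bool) (A-convex : Convex A) (x : Basis M) where

    between-closed : ∀ u v w → T (A u) → T (A v) → Between ⟦ u ⟧ ⟦ v ⟧ ⟦ w ⟧ → T (A w)
    between-closed u v w u∈A v∈A w∈uv = A-convex u v w u∈A v∈A (between⇒interval w∈uv)

    Meets : Fin n → Set
    Meets e = ∃ λ a → T (A a) × a ! e ≡ x ! e

    meets? : ∀ e → Dec (Meets e)
    meets? e = any-basis? (λ a → T? (A a) ×-dec (a ! e ≟ᵇ x ! e))

    -- Move b towards a inside A until g is the only element of b ∖ a; then exchanging a
    -- towards b at any h ∈ a ∖ b must bring in g.
    augment : ∀ a b {g} → T (A a) → T (A b) → a ! g ≡ false → b ! g ≡ true → Acc _<_ (δ b a) →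
              ∃ λ h → a ! h ≡ true × ∃ λ p → T (A p) × ⟦ p ⟧ ≡ replace ⟦ a ⟧ h g
    augment a b {g} a∈A b∈A a[g] b[g] (acc rs)
      with any? (λ e → (b ! e ≟ᵇ true) ×-dec (a ! e ≟ᵇ false) ×-dec ¬? (e ≟ g))
    ... | yes (e , b[e] , a[e] , e≢g) = augment a (result s) a∈A s∈A a[g] s[g] (rs (result-< s))
      where
      s = exchange-at b a b[e] a[e]
      s∈A = between-closed b a (result s) b∈A a∈A (result-between s)
      s[g] : result s ! g ≡ true
      s[g] = trans (replace-kept ⟦ b ⟧ (e≢g ∘ sym) (∈∉⇒≢ ⟦ a ⟧ (entering∈v s) a[g] ∘ sym)) b[g]
    ... | no ¬other =
      entering t , entering∈v t , result r ,
      between-closed a b (result r) a∈A b∈A (result-between r) ,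
      cong (replace ⟦ a ⟧ (entering t)) g′≡g
      where
      t = exchange-at b a b[g] a[g]
      r = exchange-at a b (entering∈v t) (entering∉u t)
      g′≡g : entering r ≡ g
      g′≡g = decidable-stable (entering r ≟ g)
        (λ g′≢g → ¬other (entering r , entering∈v r , entering∉u r , g′≢g))

    module _ (meets : ∀ e → Meets e) where

      exchange-stays-in-A : ∀ {a} → T (A a) → (s : Exchange a x) → T (A (result s))
      exchange-stays-in-A {a} a∈A s =
        let c , c∈A , c[f]≡x[f] = meets (leaving s)
            b , b∈A , b[g]≡x[g] = meets (entering s)
            q = exchange-at a c (leaving∈u s) (trans c[f]≡x[f] (leaving∉v s))
            q∈A = between-closed a c (result q) a∈A c∈A (result-between q)
            h , a[h] , p , p∈A , p≡a-h+g = augment a b a∈A b∈A (entering∉u s)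
              (trans b[g]≡x[g] (entering∈v s)) (<-wellFounded (δ b a))
            s∈pq = subst (λ P → Between P ⟦ result q ⟧ ⟦ result s ⟧) (sym p≡a-h+g)
              (replace-between-replacements ⟦ a ⟧ (leaving∈u s) a[h] (entering∉u s) (entering∉u q))
        in between-closed p (result q) (result s) p∈A q∈A s∈pq

      meets-everywhere⇒∈ : ∀ a → T (A a) → Acc _<_ (δ a x) → T (A x)
      meets-everywhere⇒∈ a a∈A (acc rs) with ≡⊎Exchange a x
      ... | inj₁ refl = a∈A
      ... | inj₂ s    = meets-everywhere⇒∈ (result s) (exchange-stays-in-A a∈A s) (rs (result-< s))

    SeparatingHalfspace : Set
    SeparatingHalfspace = ∃ λ H → Halfspace H × (∀ y → T (A y) → T (H y)) × T (not (H x))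

    coordinate-halfspace : ∀ e → ¬ Meets e → SeparatingHalfspace
    coordinate-halfspace e ¬meets-e =
      H , (coordinate-convex e (_xor (x ! e)) , coordinate-convex e (not ∘ (_xor (x ! e)))) ,
      (λ y y∈A → ≢⇒T-xor (λ y[e]≡x[e] → ¬meets-e (y , y∈A , y[e]≡x[e]))) ,
      subst (T ∘ not) (sym (xor-same (x ! e))) tt
      where
      H : Basis M → Bool
      H y = (y ! e) xor (x ! e)

    separating-halfspace : T (not (A x)) → SeparatingHalfspace
    separating-halfspace x∉A with any-basis? (λ a → T? (A a)) | all? meets?
    ... | no A≡∅ | _ =
      (λ _ → false) , ((λ _ _ _ ()) , (λ _ _ _ _ _ _ → tt)) , (λ a a∈A → A≡∅ (a , a∈A)) , tt
    ... | yes (a₀ , a₀∈A) | yes meets =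
      ⊥-elim (T-not⇒¬T x∉A (meets-everywhere⇒∈ meets a₀ a₀∈A (<-wellFounded (δ a₀ x))))
    ... | yes _ | no ¬meets =
      let e , ¬meets-e = ¬∀⟶∃¬ n Meets meets? ¬meets in coordinate-halfspace e ¬meets-e

  isS3 : IsS3
  isS3 A A-convex x = Separation.separating-halfspace A A-convex x

corollary7p5 : ∀ (n : ℕ) (M : Matroid n) →
    let open GraphNotions (BasisAdj M) in Connected × Meshed × IsS3
corollary7p5 n M = connected , meshed , isS3
  where open BasisGraph M
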